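{- Let $D=(b_1,\dots,b_N)$ be a general Dyck path and $R^{(0)}$ a weakly increasing rank sequence such that $T(D,R^{(0)})$ is a positive path diagram. Then: (i) in any path diagram, if row $j$ is the lowest row with $c(j)>0$, then at least one arrow starts at level $j$; (ii) the successive rank sequences $R^{(s)}$ produced by Algorithm VIB from $T(D,R^{(0)})$ are all weakly increasing; (iii) if some $T(D,R^{(s)})$ produced has no positive row counts, then it is balanced; consequently, if the algorithm terminates, the last path diagram is balanced.
   Context: A path diagram $T(D,R)$, $R=(r_1,\dots,r_N)$, consists of arrows $A_i=(1,b_i)$ starting at $(i,r_i)$ with end rank $r_i+b_i$. Red arrow: $b_i>0$, segment in row $j$ (strip between heights $j,j+1$) iff $r_i\le j\le r_i+b_i-1$; blue: $b_i<0$, segment in row $j$ iff $r_i+b_i\le j\le r_i-1$. Row count $c(j)$ = #red minus #blue segments in row $j$; balanced: all $c(j)=0$. $T$ is increasing if $R$ is weakly increasing, and positive if it is increasing and all end ranks are $\ge0$. A general Dyck path has sum $0$ and nonnegative partial sums $b_1+\dots+b_{i-1}$. Algorithm VIB: starting from $T(D,R^{(0)})$, repeat: if all row counts are $\le0$, stop; otherwise find the lowest row $j$ with $c(j)>0$, find the rightmost arrow starting at level $j$, say $A_i$, and increase $r_i$ by $1$, producing $R^{(s+1)}$ from $R^{(s)}$. -}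

module Defs where

open import Data.Nat using (ℕ; zero; suc)
open import Data.Bool using (Bool; true; false; if_then_else_; _∧_)
open import Data.Fin using (Fin; toℕ) renaming (zero to fzero; suc to fsuc; _≤_ to _≤ᶠ_; _<_ to _<ᶠ_)
open import Data.Integer using (ℤ; +_; _+_; _-_; _≤_; _<_; _<?_; _≤?_; 0ℤ; 1ℤ)
open import Data.Product using (Σ; _×_)
open import Relation.Nullary using (¬_)
open import Relation.Nullary.Decidable using (⌊_⌋)
open import Relation.Binary.PropositionalEquality using (_≡_; _≢_)
open import Data.Vec.Functional using (updateAt)
import Data.Nat as ℕ

-- A path diagram with N arrows: steps b : Fin N → ℤ, ranks r : Fin N → ℤ.
-- Arrow i starts at (i, r i) and ends at rank r i + b i.

countB : ∀ {N} → (Fin N → Bool) → ℕ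
countB {zero} f = 0
countB {suc N} f = (if f fzero then 1 else 0) ℕ.+ countB (λ i → f (fsuc i))

sumFin : ∀ {N} → (Fin N → ℤ) → ℤ
sumFin {zero} f = 0ℤ
sumFin {suc N} f = f fzero + sumFin (λ i → f (fsuc i))

prefixSum : ∀ {N} → (Fin N → ℤ) → ℕ → ℤ
prefixSum f k = sumFin (λ i → if toℕ i ℕ.<ᵇ k then f i else 0ℤ)

GeneralDyck : ∀ {N} → (Fin N → ℤ) → Set
GeneralDyck {N} b =
  (∀ i → b i ≢ 0ℤ) × (sumFin b ≡ 0ℤ) × (∀ (i : Fin N) → 0ℤ ≤ prefixSum b (toℕ i))

redSeg : ℤ → ℤ → ℤ → Bool
redSeg bi ri j = ⌊ 0ℤ <? bi ⌋ ∧ ⌊ ri ≤? j ⌋ ∧ ⌊ j <? ri + bi ⌋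

blueSeg : ℤ → ℤ → ℤ → Bool
blueSeg bi ri j = ⌊ bi <? 0ℤ ⌋ ∧ ⌊ ri + bi ≤? j ⌋ ∧ ⌊ j <? ri ⌋

rowCount : ∀ {N} → (Fin N → ℤ) → (Fin N → ℤ) → ℤ → ℤ
rowCount b r j = + countB (λ i → redSeg (b i) (r i) j) - + countB (λ i → blueSeg (b i) (r i) j)

Balanced : ∀ {N} → (Fin N → ℤ) → (Fin N → ℤ) → Set
Balanced b r = ∀ j → rowCount b r j ≡ 0ℤ

WeaklyIncreasing : ∀ {N} → (Fin N → ℤ) → Set
WeaklyIncreasing r = ∀ i k → i ≤ᶠ k → r i ≤ r k

Positive : ∀ {N} → (Fin N → ℤ) → (Fin N → ℤ) → Set
Positive b r = WeaklyIncreasing r × (∀ i → 0ℤ ≤ r i + b i)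

VIBStep : ∀ {N} → (Fin N → ℤ) → (Fin N → ℤ) → (Fin N → ℤ) → Set
VIBStep {N} b r r' =
  Σ ℤ λ j → (0ℤ < rowCount b r j) × (∀ k → k < j → rowCount b r k ≤ 0ℤ) ×
  Σ (Fin N) λ i → (r i ≡ j) × (∀ i' → i <ᶠ i' → r i' ≢ j) ×
  (∀ k → r' k ≡ updateAt r i (λ x → x + 1ℤ) k)

-- Row j is crossed by every arrow starting at or below j and ending above it, counted +1 if red
-- and -1 if blue, so c(j) = #{i : r_i ≤ j} - #{i : r_i + b_i ≤ j}.  (i) If no arrow starts at level
-- j, then passing from row j-1 to row j adds no starts, so c(j) ≤ c(j-1) ≤ 0.  (ii) The raised arrow
-- is the rightmost one at its level, so every arrow to its right starts strictly higher and
-- therefore still no lower than the raised arrow.  (iii) Summing c over a window of rows containing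
-- all starts and ends telescopes, arrow by arrow, to Σ (r_i + b_i - r_i) = Σ b_i = 0; nonpositive
-- integers with sum 0 all vanish.

module Submission where

open import Defs
open import Data.Bool using (Bool; if_then_else_; _∧_)
open import Data.Empty using (⊥-elim)
open import Data.Fin using (Fin; toℕ) renaming (zero to fzero; suc to fsuc; _<_ to _<ᶠ_)
import Data.Fin.Properties as Fin
open import Data.Integer
  using (ℤ; +_; -[1+_]; -_; _+_; _-_; 0ℤ; 1ℤ; _≤_; _<_; _≤?_; _<?_; ∣_∣; pred; +≤+; -≤+)
  renaming (suc to sucℤ)
import Data.Integer.Properties as ℤ
open import Algebra.Properties.CommutativeMonoid.Sum ℤ.+-0-commutativeMonoid
  using (sum; sum-cong-≗; sum-replicate-zero; ∑-comm)
open import Data.Integer.Tactic.RingSolver using (solve-∀)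
open import Data.Nat as ℕ using (ℕ; zero; suc; _⊔_)
import Data.Nat.Properties as ℕₚ
open import Data.Product using (Σ; ∃-syntax; _×_; _,_; proj₁; proj₂)
open import Data.Vec.Functional using (updateAt)
open import Data.Vec.Functional.Properties using (updateAt-updates; updateAt-minimal)
open import Function using (_∘_; id)
open import Relation.Binary.Construct.Closure.ReflexiveTransitive using (Star; fold)
open import Relation.Binary.PropositionalEquality
open import Relation.Nullary using (¬_; yes; no)
open import Relation.Nullary.Decidable using (⌊_⌋)

sumFin≡sum : ∀ {n} (f : Fin n → ℤ) → sumFin f ≡ sum f
sumFin≡sum {zero} f = refl
sumFin≡sum {suc n} f = cong (_+_ (f fzero)) (sumFin≡sum (f ∘ fsuc))

∑-distrib-− : ∀ {n} (f g : Fin n → ℤ) → sum (λ i → f i - g i) ≡ sum f - sum g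
∑-distrib-− {zero} f g = refl
∑-distrib-− {suc n} f g =
  trans (cong (_+_ (f fzero - g fzero)) (∑-distrib-− (f ∘ fsuc) (g ∘ fsuc)))
        (regroup (f fzero) (g fzero) (sum (f ∘ fsuc)) (sum (g ∘ fsuc)))
  where
  regroup : ∀ a b c d → (a - b) + (c - d) ≡ (a + c) - (b + d)
  regroup = solve-∀

sum-mono-≤ : ∀ {n} {f g : Fin n → ℤ} → (∀ i → f i ≤ g i) → sum f ≤ sum g
sum-mono-≤ {zero} f≤g = ℤ.≤-refl
sum-mono-≤ {suc n} f≤g = ℤ.+-mono-≤ (f≤g fzero) (sum-mono-≤ (f≤g ∘ fsuc))

+-nonpos-zeroˡ : ∀ {a b} → a ≤ 0ℤ → b ≤ 0ℤ → a + b ≡ 0ℤ → a ≡ 0ℤ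
+-nonpos-zeroˡ {a} {b} a≤0 b≤0 a+b≡0 = ℤ.≤-antisym a≤0 (begin
  0ℤ     ≡⟨ a+b≡0 ⟨
  a + b  ≤⟨ ℤ.+-monoʳ-≤ a b≤0 ⟩
  a + 0ℤ ≡⟨ ℤ.+-identityʳ a ⟩
  a      ∎)
  where open ℤ.≤-Reasoning

sum-nonpos : ∀ {n} {f : Fin n → ℤ} → (∀ i → f i ≤ 0ℤ) → sum f ≤ 0ℤ
sum-nonpos {n} {f} f≤0 = subst (sum f ≤_) (sum-replicate-zero n) (sum-mono-≤ f≤0)

sum-nonpos-zero : ∀ {n} {f : Fin n → ℤ} → (∀ i → f i ≤ 0ℤ) → sum f ≡ 0ℤ → ∀ i → f i ≡ 0ℤ
sum-nonpos-zero {suc n} {f} f≤0 Σf≡0 fzero =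
  +-nonpos-zeroˡ (f≤0 fzero) (sum-nonpos (f≤0 ∘ fsuc)) Σf≡0
sum-nonpos-zero {suc n} {f} f≤0 Σf≡0 (fsuc i) =
  sum-nonpos-zero (f≤0 ∘ fsuc)
    (+-nonpos-zeroˡ (sum-nonpos (f≤0 ∘ fsuc)) (f≤0 fzero) (trans (ℤ.+-comm _ (f fzero)) Σf≡0)) i

𝟙 : Bool → ℤ
𝟙 x = + (if x then 1 else 0)

𝟙[_≤_] : ℤ → ℤ → ℤ
𝟙[ x ≤ j ] = 𝟙 ⌊ x ≤? j ⌋

𝟙[≤]-true : ∀ {x j} → x ≤ j → 𝟙[ x ≤ j ] ≡ 1ℤ
𝟙[≤]-true {x} {j} x≤j with x ≤? j
... | yes _   = refl
... | no x≰j = ⊥-elim (x≰j x≤j)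

𝟙[≤]-false : ∀ {x j} → ¬ x ≤ j → 𝟙[ x ≤ j ] ≡ 0ℤ
𝟙[≤]-false {x} {j} x≰j with x ≤? j
... | yes x≤j = ⊥-elim (x≰j x≤j)
... | no _    = refl

countB≡sum : ∀ {n} (f : Fin n → Bool) → + countB f ≡ sum (𝟙 ∘ f)
countB≡sum {zero} f = refl
countB≡sum {suc n} f = cong (_+_ (𝟙 (f fzero))) (countB≡sum (f ∘ fsuc))

𝟙-interval : ∀ {x y} j → x ≤ y → 𝟙 (⌊ x ≤? j ⌋ ∧ ⌊ j <? y ⌋) ≡ 𝟙[ x ≤ j ] - 𝟙[ y ≤ j ]
𝟙-interval {x} {y} j x≤y with x ≤? j | j <? y | y ≤? j
... | yes _   | yes j<y | yes y≤j = ⊥-elim (ℤ.<⇒≱ j<y y≤j)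
... | yes _   | yes _   | no _    = refl
... | yes _   | no _    | yes _   = refl
... | yes _   | no j≮y  | no y≰j  = ⊥-elim (y≰j (ℤ.≮⇒≥ j≮y))
... | no x≰j  | _       | yes y≤j = ⊥-elim (x≰j (ℤ.≤-trans x≤y y≤j))
... | no _    | _       | no _    = refl

segments≡𝟙-difference : ∀ b r j →
  𝟙 (redSeg b r j) - 𝟙 (blueSeg b r j) ≡ 𝟙[ r ≤ j ] - 𝟙[ r + b ≤ j ]
segments≡𝟙-difference b r j with 0ℤ <? b | b <? 0ℤ
... | yes 0<b | yes b<0 = ⊥-elim (ℤ.<-asym 0<b b<0)
... | yes 0<b | no _    = trans (ℤ.+-identityʳ _) (𝟙-interval j (r≤r+b (ℤ.<⇒≤ 0<b)))
  where
  r≤r+b : 0ℤ ≤ b → r ≤ r + b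
  r≤r+b 0≤b = subst (_≤ r + b) (ℤ.+-identityʳ r) (ℤ.+-monoʳ-≤ r 0≤b)
... | no _    | yes b<0 = trans (cong (_-_ 0ℤ) (𝟙-interval j r+b≤r)) (flip 𝟙[ r + b ≤ j ] 𝟙[ r ≤ j ])
  where
  r+b≤r : r + b ≤ r
  r+b≤r = subst (r + b ≤_) (ℤ.+-identityʳ r) (ℤ.+-monoʳ-≤ r (ℤ.<⇒≤ b<0))
  flip : ∀ a c → 0ℤ - (a - c) ≡ c - a
  flip = solve-∀
... | no 0≮b  | no b≮0  = begin
  0ℤ                                 ≡⟨ ℤ.+-inverseʳ 𝟙[ r ≤ j ] ⟨
  𝟙[ r ≤ j ] - 𝟙[ r ≤ j ]           ≡⟨ cong (λ e → 𝟙[ r ≤ j ] - 𝟙[ e ≤ j ]) r≡r+b ⟩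
  𝟙[ r ≤ j ] - 𝟙[ r + b ≤ j ]       ∎
  where
  open ≡-Reasoning
  r≡r+b : r ≡ r + b
  r≡r+b = trans (sym (ℤ.+-identityʳ r)) (cong (_+_ r) (ℤ.≤-antisym (ℤ.≮⇒≥ b≮0) (ℤ.≮⇒≥ 0≮b)))

rowCount≡∑-start-end : ∀ {n} (b r : Fin n → ℤ) j →
  rowCount b r j ≡ sum (λ i → 𝟙[ r i ≤ j ] - 𝟙[ r i + b i ≤ j ])
rowCount≡∑-start-end b r j = begin
  rowCount b r j
    ≡⟨ cong₂ _-_ (countB≡sum red) (countB≡sum blue) ⟩
  sum (𝟙 ∘ red) - sum (𝟙 ∘ blue)
    ≡⟨ ∑-distrib-− (𝟙 ∘ red) (𝟙 ∘ blue) ⟨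
  sum (λ i → 𝟙 (red i) - 𝟙 (blue i))
    ≡⟨ sum-cong-≗ (λ i → segments≡𝟙-difference (b i) (r i) j) ⟩
  sum (λ i → 𝟙[ r i ≤ j ] - 𝟙[ r i + b i ≤ j ]) ∎
  where
  open ≡-Reasoning
  red blue : Fin _ → Bool
  red i = redSeg (b i) (r i) j
  blue i = blueSeg (b i) (r i) j

𝟙[≤]-mono : ∀ x {j k} → j ≤ k → 𝟙[ x ≤ j ] ≤ 𝟙[ x ≤ k ]
𝟙[≤]-mono x {j} {k} j≤k with x ≤? j | x ≤? k
... | yes _   | yes _  = ℤ.≤-refl
... | yes x≤j | no x≰k = ⊥-elim (x≰k (ℤ.≤-trans x≤j j≤k))
... | no _    | yes _  = +≤+ ℕ.z≤n
... | no _    | no _   = ℤ.≤-refl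

𝟙[≤]-pred : ∀ {x j} → x ≢ j → 𝟙[ x ≤ j ] ≡ 𝟙[ x ≤ pred j ]
𝟙[≤]-pred {x} {j} x≢j with x ≤? j | x ≤? pred j
... | yes _   | yes _    = refl
... | yes x≤j | no x≰j-1 = ⊥-elim (x≰j-1 (ℤ.i<j⇒i≤pred[j] (ℤ.≤∧≢⇒< x≤j x≢j)))
... | no x≰j  | yes x≤j-1 = ⊥-elim (x≰j (ℤ.<⇒≤ (ℤ.i≤pred[j]⇒i<j x≤j-1)))
... | no _    | no _     = refl

pred[j]<j : ∀ j → pred j < j
pred[j]<j j = ℤ.i≤pred[j]⇒i<j ℤ.≤-refl

rowCount-≤-pred : ∀ {n} (b r : Fin n → ℤ) j → (∀ i → r i ≢ j) →
  rowCount b r j ≤ rowCount b r (pred j)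
rowCount-≤-pred b r j no-start
  rewrite rowCount≡∑-start-end b r j | rowCount≡∑-start-end b r (pred j) =
  sum-mono-≤ λ i → ℤ.+-mono-≤ (ℤ.≤-reflexive (𝟙[≤]-pred (no-start i)))
                               (ℤ.neg-mono-≤ (𝟙[≤]-mono (r i + b i) (ℤ.<⇒≤ (pred[j]<j j))))

lowest-positive-row-has-start : ∀ {n} (b r : Fin n → ℤ) j → 0ℤ < rowCount b r j →
  (∀ k → k < j → rowCount b r k ≤ 0ℤ) → Σ (Fin n) λ i → r i ≡ j
lowest-positive-row-has-start b r j 0<c[j] c≤0-below with Fin.any? (λ i → r i ℤ.≟ j)
... | yes start = start
... | no no-start = ⊥-elim (ℤ.<⇒≱ 0<c[j] (ℤ.≤-trans c[j]≤c[j-1] (c≤0-below (pred j) (pred[j]<j j))))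
  where
  c[j]≤c[j-1] : rowCount b r j ≤ rowCount b r (pred j)
  c[j]≤c[j-1] = rowCount-≤-pred b r j (λ i r[i]≡j → no-start (i , r[i]≡j))

increment-rightmost-weaklyIncreasing : ∀ {n} {r : Fin n → ℤ} {i} → WeaklyIncreasing r →
  (∀ k → i <ᶠ k → r k ≢ r i) → WeaklyIncreasing (updateAt r i (λ x → x + 1ℤ))
increment-rightmost-weaklyIncreasing {r = r} {i} r↑ rightmost p q p≤q with p Fin.≟ i | q Fin.≟ i
... | yes refl | yes refl = ℤ.≤-refl
... | yes refl | no q≢p
  rewrite updateAt-updates p {λ x → x + 1ℤ} r | updateAt-minimal q p {λ x → x + 1ℤ} r q≢p =
  subst (_≤ r q) (ℤ.+-comm 1ℤ (r p)) (ℤ.i<j⇒suc[i]≤j (ℤ.≤∧≢⇒< (r↑ p q p≤q) r[p]≢r[q]))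
  where
  r[p]≢r[q] : r p ≢ r q
  r[p]≢r[q] r[p]≡r[q] = rightmost q (Fin.≤∧≢⇒< p≤q (q≢p ∘ sym)) (sym r[p]≡r[q])
... | no p≢q | yes refl
  rewrite updateAt-updates q {λ x → x + 1ℤ} r | updateAt-minimal p q {λ x → x + 1ℤ} r p≢q =
  ℤ.≤-trans (r↑ p q p≤q) (ℤ.i≤i+j (r q) 1ℤ)
... | no p≢i | no q≢i
  rewrite updateAt-minimal p i {λ x → x + 1ℤ} r p≢i | updateAt-minimal q i {λ x → x + 1ℤ} r q≢i =
  r↑ p q p≤q

vibStep-weaklyIncreasing : ∀ {n} {b r r' : Fin n → ℤ} → VIBStep b r r' →
  WeaklyIncreasing r → WeaklyIncreasing r'
vibStep-weaklyIncreasing {r = r} (j , _ , _ , i , r[i]≡j , rightmost , r'≗) r↑ p q p≤q =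
  subst₂ _≤_ (sym (r'≗ p)) (sym (r'≗ q))
    (increment-rightmost-weaklyIncreasing r↑ rightmost′ p q p≤q)
  where
  rightmost′ : ∀ k → i <ᶠ k → r k ≢ r i
  rightmost′ k i<k r[k]≡r[i] = rightmost k i<k (trans r[k]≡r[i] r[i]≡j)

vibRun-weaklyIncreasing : ∀ {n} (b : Fin n → ℤ) {r₀ r} → Star (VIBStep b) r₀ r →
  WeaklyIncreasing r₀ → WeaklyIncreasing r
vibRun-weaklyIncreasing b =
  fold (λ x y → WeaklyIncreasing x → WeaklyIncreasing y)
       (λ step rest → rest ∘ vibStep-weaklyIncreasing {b = b} step) id

rowSum : ℤ → ℕ → (ℤ → ℤ) → ℤ
rowSum L M f = sum (λ (t : Fin M) → f (L + + toℕ t))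

infix 4 _∈[_,_]
_∈[_,_] : ℤ → ℤ → ℤ → Set
x ∈[ L , U ] = L ≤ x × x ≤ U

+suc≡suc+ : ∀ L n → L + + suc n ≡ sucℤ L + + n
+suc≡suc+ L n = shift L (+ n)
  where
  shift : ∀ L m → L + (1ℤ + m) ≡ (1ℤ + L) + m
  shift = solve-∀

rowSum-suc : ∀ L M f → rowSum L (suc M) f ≡ f L + rowSum (sucℤ L) M f
rowSum-suc L M f =
  cong₂ _+_ (cong f (ℤ.+-identityʳ L)) (sum-cong-≗ {M} (λ t → cong f (+suc≡suc+ L (toℕ t))))

rowSum-𝟙-below : ∀ {x L} M → x ≤ L → rowSum L M (λ k → 𝟙[ x ≤ k ]) ≡ + M
rowSum-𝟙-below zero x≤L = refl
rowSum-𝟙-below {x} {L} (suc M) x≤L = trans (rowSum-suc L M (λ k → 𝟙[ x ≤ k ]))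
  (cong₂ _+_ (𝟙[≤]-true x≤L) (rowSum-𝟙-below M (ℤ.≤-trans x≤L (ℤ.i≤suc[i] L))))

rowSum-𝟙 : ∀ {x} L M → x ∈[ L , L + + M ] → rowSum L M (λ k → 𝟙[ x ≤ k ]) ≡ L + + M - x
rowSum-𝟙 {x} L zero (L≤x , x≤L+0) =
  sym (trans (cong (_-_ (L + + 0)) x≡L+0) (ℤ.+-inverseʳ (L + + 0)))
  where
  x≡L+0 : x ≡ L + + 0
  x≡L+0 = ℤ.≤-antisym x≤L+0 (subst (_≤ x) (sym (ℤ.+-identityʳ L)) L≤x)
rowSum-𝟙 {x} L (suc M) (L≤x , x≤U) with x ≤? L
... | yes x≤L = begin
  rowSum L (suc M) (λ k → 𝟙[ x ≤ k ])
    ≡⟨ rowSum-suc L M (λ k → 𝟙[ x ≤ k ]) ⟩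
  𝟙[ x ≤ L ] + rowSum (sucℤ L) M (λ k → 𝟙[ x ≤ k ])
    ≡⟨ cong₂ _+_ (𝟙[≤]-true x≤L) (rowSum-𝟙-below M (ℤ.≤-trans x≤L (ℤ.i≤suc[i] L))) ⟩
  + suc M
    ≡⟨ cancel L (+ suc M) ⟨
  L + + suc M - L
    ≡⟨ cong (_-_ (L + + suc M)) (ℤ.≤-antisym L≤x x≤L) ⟩
  L + + suc M - x ∎
  where
  open ≡-Reasoning
  cancel : ∀ L m → L + m - L ≡ m
  cancel = solve-∀
... | no x≰L = begin
  rowSum L (suc M) (λ k → 𝟙[ x ≤ k ])
    ≡⟨ rowSum-suc L M (λ k → 𝟙[ x ≤ k ]) ⟩
  𝟙[ x ≤ L ] + rowSum (sucℤ L) M (λ k → 𝟙[ x ≤ k ])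
    ≡⟨ cong₂ _+_ (𝟙[≤]-false x≰L) (rowSum-𝟙 (sucℤ L) M (L+1≤x , subst (x ≤_) (+suc≡suc+ L M) x≤U)) ⟩
  0ℤ + (sucℤ L + + M - x)
    ≡⟨ ℤ.+-identityˡ _ ⟩
  sucℤ L + + M - x
    ≡⟨ cong (_- x) (+suc≡suc+ L M) ⟨
  L + + suc M - x ∎
  where
  open ≡-Reasoning
  L+1≤x : sucℤ L ≤ x
  L+1≤x = ℤ.i<j⇒suc[i]≤j (ℤ.≰⇒> x≰L)

rowSum-𝟙-difference : ∀ {x y} L M → x ∈[ L , L + + M ] → y ∈[ L , L + + M ] →
  rowSum L M (λ k → 𝟙[ x ≤ k ] - 𝟙[ y ≤ k ]) ≡ y - x
rowSum-𝟙-difference {x} {y} L M x∈ y∈ = begin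
  rowSum L M (λ k → 𝟙[ x ≤ k ] - 𝟙[ y ≤ k ])
    ≡⟨ ∑-distrib-− {M} (λ t → 𝟙[ x ≤ L + + toℕ t ]) (λ t → 𝟙[ y ≤ L + + toℕ t ]) ⟩
  rowSum L M (λ k → 𝟙[ x ≤ k ]) - rowSum L M (λ k → 𝟙[ y ≤ k ])
    ≡⟨ cong₂ _-_ (rowSum-𝟙 L M x∈) (rowSum-𝟙 L M y∈) ⟩
  (L + + M - x) - (L + + M - y)
    ≡⟨ cancel (L + + M) x y ⟩
  y - x ∎
  where
  open ≡-Reasoning
  cancel : ∀ u x y → (u - x) - (u - y) ≡ y - x
  cancel = solve-∀

rowSum-rowCount : ∀ {n} (b r : Fin n → ℤ) L M →
  (∀ i → r i ∈[ L , L + + M ] × r i + b i ∈[ L , L + + M ]) → rowSum L M (rowCount b r) ≡ sum b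
rowSum-rowCount {n} b r L M endpoints∈ = begin
  rowSum L M (rowCount b r)
    ≡⟨ sum-cong-≗ {M} (λ t → rowCount≡∑-start-end b r (L + + toℕ t)) ⟩
  sum (λ (t : Fin M) → sum (λ i → 𝟙[ r i ≤ L + + toℕ t ] - 𝟙[ r i + b i ≤ L + + toℕ t ]))
    ≡⟨ ∑-comm {M} {n} _ ⟩
  sum (λ i → rowSum L M (λ k → 𝟙[ r i ≤ k ] - 𝟙[ r i + b i ≤ k ]))
    ≡⟨ sum-cong-≗ (λ i → rowSum-𝟙-difference L M (proj₁ (endpoints∈ i)) (proj₂ (endpoints∈ i))) ⟩
  sum (λ i → r i + b i - r i)
    ≡⟨ sum-cong-≗ (λ i → cancel (r i) (b i)) ⟩
  sum b ∎
  where
  open ≡-Reasoning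
  cancel : ∀ r b → r + b - r ≡ b
  cancel = solve-∀

row-index : ∀ {L k} M → L ≤ k → k < L + + M → Σ (Fin M) λ t → L + + toℕ t ≡ k
row-index {L} {k} zero L≤k k<L+0 = ⊥-elim (ℤ.<⇒≱ k<L+0 (subst (_≤ k) (sym (ℤ.+-identityʳ L)) L≤k))
row-index {L} {k} (suc M) L≤k k<L+1+M with L ℤ.≟ k
... | yes refl = fzero , ℤ.+-identityʳ L
... | no L≢k =
  let t , L+1+t≡k = row-index M (ℤ.i<j⇒suc[i]≤j (ℤ.≤∧≢⇒< L≤k L≢k)) (subst (k <_) (+suc≡suc+ L M) k<L+1+M)
  in fsuc t , trans (+suc≡suc+ L (toℕ t)) L+1+t≡k

rowSum-nonpos-zero : ∀ {f : ℤ → ℤ} {L} M → (∀ k → f k ≤ 0ℤ) → rowSum L M f ≡ 0ℤ →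
  ∀ {k} → L ≤ k → k < L + + M → f k ≡ 0ℤ
rowSum-nonpos-zero {f} M f≤0 Σ≡0 L≤k k<L+M =
  let t , L+t≡k = row-index M L≤k k<L+M
  in subst (λ k → f k ≡ 0ℤ) L+t≡k (sum-nonpos-zero (λ _ → f≤0 _) Σ≡0 t)

bounded : ∀ {n} (x : Fin n → ℤ) → ∃[ K ] (∀ i → ∣ x i ∣ ℕ.≤ K)
bounded {zero} x = 0 , λ ()
bounded {suc n} x =
  let K , ∣x∣≤K = bounded (x ∘ fsuc)
  in ∣ x fzero ∣ ⊔ K , λ { fzero → ℕₚ.m≤m⊔n _ K ; (fsuc i) → ℕₚ.≤-trans (∣x∣≤K i) (ℕₚ.m≤n⊔m _ K) }

∣∣≤⇒∈[-,+] : ∀ {x K} → ∣ x ∣ ℕ.≤ K → x ∈[ - + K , + K ]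
∣∣≤⇒∈[-,+] {+ n} n≤K = ℤ.≤-trans (ℤ.neg-mono-≤ (+≤+ n≤K)) ℤ.neg-≤-pos , +≤+ n≤K
∣∣≤⇒∈[-,+] { -[1+ n ]} 1+n≤K = ℤ.neg-mono-≤ (+≤+ 1+n≤K) , -≤+

nonpositive-rowCounts-balanced : ∀ {n} (b r : Fin n → ℤ) → sum b ≡ 0ℤ →
  (∀ j → rowCount b r j ≤ 0ℤ) → Balanced b r
nonpositive-rowCounts-balanced b r Σb≡0 c≤0 j =
  rowSum-nonpos-zero M c≤0 window≡0 (proj₁ (in-window ∣j∣≤K)) (proj₂ (in-window ∣j∣≤K))
  where
  Kr = proj₁ (bounded r)
  Ke = proj₁ (bounded (λ i → r i + b i))
  K = Kr ℕ.+ Ke ℕ.+ ∣ j ∣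
  L = - + K
  M = suc (K ℕ.+ K)
  ∣j∣≤K : ∣ j ∣ ℕ.≤ K
  ∣j∣≤K = ℕₚ.m≤n+m ∣ j ∣ (Kr ℕ.+ Ke)
  window-top : ∀ k → - k + (1ℤ + (k + k)) ≡ 1ℤ + k
  window-top = solve-∀
  in-window : ∀ {x} → ∣ x ∣ ℕ.≤ K → L ≤ x × x < L + + M
  in-window ∣x∣≤K =
    let L≤x , x≤K = ∣∣≤⇒∈[-,+] ∣x∣≤K
    in L≤x , ℤ.≤-<-trans x≤K (subst (+ K <_) (sym (window-top (+ K))) (ℤ.suc[i]≤j⇒i<j ℤ.≤-refl))
  in-window≤ : ∀ {x} → ∣ x ∣ ℕ.≤ K → x ∈[ L , L + + M ]
  in-window≤ ∣x∣≤K = proj₁ (in-window ∣x∣≤K) , ℤ.<⇒≤ (proj₂ (in-window ∣x∣≤K))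
  endpoints∈ : ∀ i → r i ∈[ L , L + + M ] × r i + b i ∈[ L , L + + M ]
  endpoints∈ i =
    in-window≤ (ℕₚ.≤-trans (proj₂ (bounded r) i) (ℕₚ.≤-trans (ℕₚ.m≤m+n Kr Ke) (ℕₚ.m≤m+n _ ∣ j ∣))) ,
    in-window≤ (ℕₚ.≤-trans (proj₂ (bounded (λ i → r i + b i)) i) (ℕₚ.≤-trans (ℕₚ.m≤n+m Ke Kr) (ℕₚ.m≤m+n _ ∣ j ∣)))
  window≡0 : rowSum L M (rowCount b r) ≡ 0ℤ
  window≡0 = trans (rowSum-rowCount b r L M endpoints∈) Σb≡0

lemma6 : ((N : ℕ) (b r : Fin N → ℤ) (j : ℤ) → 0ℤ < rowCount b r j →
           (∀ k → k < j → rowCount b r k ≤ 0ℤ) → Σ (Fin N) λ i → r i ≡ j)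
         × ((N : ℕ) (b r₀ : Fin N → ℤ) → GeneralDyck b → Positive b r₀ →
           (∀ r → Star (VIBStep b) r₀ r → WeaklyIncreasing r)
           × (∀ r → Star (VIBStep b) r₀ r → (∀ j → rowCount b r j ≤ 0ℤ) → Balanced b r))
lemma6 = (λ _ → lowest-positive-row-has-start) , λ _ b r₀ (_ , Σb≡0 , _) (r₀↑ , _) →
  (λ r run → vibRun-weaklyIncreasing b run r₀↑) ,
  (λ r _ c≤0 → nonpositive-rowCounts-balanced b r (trans (sym (sumFin≡sum b)) Σb≡0) c≤0)
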